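{- Let $n\ge1$. A graph $\Gamma$ is a Carter diagram of type $A_n$ if and only if $\Gamma$ is a connected graph on $n$ vertices which is the union of subgraphs $\Gamma_1,\dots,\Gamma_k$ such that: (i) $\Gamma_1,\dots,\Gamma_k$ are complete graphs; (ii) $\Gamma_i$ and $\Gamma_j$ ($i\ne j$) intersect in at most one vertex; (iii) every vertex of $\Gamma$ belongs to at most two of the subgraphs $\Gamma_i$; (iv) $\sum_{i=1}^k(|\Gamma_i|-1)=n-1$, where $|\Gamma_i|$ denotes the number of vertices of $\Gamma_i$.
   Context: A Carter diagram of type $A_n$: for a crystallographic root system and linearly independent roots $\beta_1,\dots,\beta_n$ whose smallest containing root subsystem is of type $A_n$, the graph with vertices $\beta_i$ and distinct $\beta_i,\beta_j$ joined by $\frac{2(\beta_i\mid\beta_j)}{(\beta_i\mid\beta_i)}\cdot\frac{2(\beta_j\mid\beta_i)}{(\beta_j\mid\beta_j)}$ edges (all edges have multiplicity at most one in this type). Equivalently, it is the graph on $t_1,\dots,t_n$, with edges between non-commuting elements, for transpositions $t_1,\dots,t_n$ generating $\mathrm{Sym}([n+1])$. -}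

module Defs where

open import Data.Nat using (ℕ; suc; _≤_; _∸_)
open import Data.Bool using (Bool; true; false)
open import Data.Fin using (Fin)
open import Data.Fin.Subset using (Subset; _∈_; _∩_; ∣_∣; Nonempty)
open import Data.Fin.Permutation using (Permutation′; transpose; _∘ₚ_; _≈_; id)
open import Data.List using (List; []; _∷_; foldr; map; allFin)
open import Data.Nat.ListAction using (sum)
open import Data.Vec using (tabulate; lookup)
open import Data.Product using (Σ; ∃; ∃-syntax; _×_)
open import Relation.Binary.PropositionalEquality using (_≡_; _≢_)
open import Relation.Nullary using (¬_)

record Graph (n : ℕ) : Set where
  field
    adj    : Fin n → Fin n → Bool
    symm   : ∀ u v → adj u v ≡ adj v u
    irrefl : ∀ v → adj v v ≡ false
open Graph public

record Transposition (m : ℕ) : Set where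
  constructor ⟪_,_,_⟫
  field
    a b  : Fin m
    a≢b : a ≢ b

toPerm : ∀ {m} → Transposition m → Permutation′ m
toPerm t = transpose (Transposition.a t) (Transposition.b t)

prod : ∀ {m} → List (Permutation′ m) → Permutation′ m
prod = foldr _∘ₚ_ id

-- The family t generates the symmetric group Sym(Fin m): every permutation
-- is a product of the t i (transpositions are involutions, so no inverses
-- are needed).
Generates : ∀ {n m} → (Fin n → Transposition m) → Set
Generates {n} {m} t =
  ∀ (π : Permutation′ m) → ∃[ w ] (π ≈ prod (map (λ i → toPerm (t i)) w))

Commute : ∀ {m} → Permutation′ m → Permutation′ m → Set
Commute σ τ = (σ ∘ₚ τ) ≈ (τ ∘ₚ σ)

IsCarterA : ∀ {n} → Graph n → Set
IsCarterA {n} Γ =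
  Σ (Fin n → Transposition (suc n)) λ t →
    Generates t ×
    (∀ u v → u ≢ v → (adj Γ u v ≡ true → ¬ Commute (toPerm (t u)) (toPerm (t v)))
                   × (¬ Commute (toPerm (t u)) (toPerm (t v)) → adj Γ u v ≡ true))

data Reach {n} (Γ : Graph n) : Fin n → Fin n → Set where
  here : ∀ {v} → Reach Γ v v
  step : ∀ {u v w} → adj Γ u v ≡ true → Reach Γ v w → Reach Γ u w

Connected : ∀ {n} → Graph n → Set
Connected Γ = ∀ u v → Reach Γ u v

-- Decomposition into complete subgraphs Γ_1..Γ_k, given by their vertex
-- sets C i (a complete subgraph is determined by its vertex set).

IsUnionOfCliques : ∀ {n k} → Graph n → (Fin k → Subset n) → Set
IsUnionOfCliques {n} {k} Γ C =
  (∀ v → ∃[ i ] (v ∈ C i)) ×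
  (∀ u v → u ≢ v → (adj Γ u v ≡ true → ∃[ i ] (u ∈ C i × v ∈ C i))
                 × (∃[ i ] (u ∈ C i × v ∈ C i) → adj Γ u v ≡ true))

memberships : ∀ {n k} → (Fin k → Subset n) → Fin n → Subset k
memberships C v = tabulate (λ i → lookup (C i) v)

CliqueDecomposition : ∀ {n} → Graph n → Set
CliqueDecomposition {n} Γ =
  Σ ℕ λ k → Σ (Fin k → Subset n) λ C →
    IsUnionOfCliques Γ C ×
    (∀ i → Nonempty (C i)) ×                                   -- graphs are nonempty
    (∀ i j → i ≢ j → ∣ C i ∩ C j ∣ ≤ 1) ×
    (∀ v → ∣ memberships C v ∣ ≤ 2) ×
    (sum (map (λ i → ∣ C i ∣ ∸ 1) (allFin k)) ≡ n ∸ 1)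

-- Read a family of transpositions of a finite set as a graph on its points, each transposition being an
-- edge. The family generates the symmetric group exactly when this graph is connected, and a connected graph
-- on m points has at least m - 1 edges. So a Carter labelling of n vertices by transpositions of n + 1 points
-- is a spanning tree: distinct vertices carry distinct transpositions, two of them fail to commute exactly
-- when they share a point, and the cliques are the sets of vertices through a fixed point. Every vertex lies
-- on two points, which gives (iii) and, by double counting, (iv). Conversely, a vertex lying in two cliques
-- becomes the transposition of those two cliques and a vertex lying in one clique the transposition of that
-- clique and a new private point; connectivity of the graph links all points, and (iii) with (iv) show that
-- there are exactly n + 1 points.
module Submission where

open import Data.Bool using (Bool; true; false)
open import Data.Fin using (Fin; zero; suc; toℕ; fromℕ<; punchIn; punchOut; join; splitAt)
open import Data.Fin.Properties
  using (_≟_; any?; suc-injective; toℕ-injective; toℕ-fromℕ<; toℕ<n; punchIn-punchOut; splitAt-join; join-splitAt)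
open import Data.Fin.Permutation using (Permutation′; transpose; _∘ₚ_; _≈_; id; _⟨$⟩ʳ_; _⟨$⟩ˡ_; inverseˡ)
import Data.Fin.Permutation.Components as PC
open import Data.Fin.Subset using (Subset; inside; outside; _∈_; _∉_; ⁅_⁆; ⊤; _∩_; ∣_∣; Nonempty)
open import Data.Fin.Subset.Properties
  using (_∈?_; nonempty?; Empty-unique; ∣⊥∣≡0; ∣⊤∣≡n; ∣⁅x⁆∣≡1; p⊆q⇒∣p∣≤∣q∣; x∈⁅x⁆; x∈p⇒∣p-x∣<∣p∣;
         x∈p∧x≢y⇒x∈p-y; drop-there; ∣p∣≤∣x∷p∣; x∈p∩q⁺; x∈p∩q⁻)
open import Data.List using (List; []; _∷_; map; _++_; allFin)
import Data.List as List
open import Data.List.Properties using (map-tabulate)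
open import Data.Nat using (ℕ; zero; suc; _+_; _≤_; _∸_; z≤n; s≤s)
open import Data.Nat.ListAction using (sum)
open import Data.Nat.Properties
  using (≤-refl; ≤-trans; ≤-reflexive; ≤-antisym; <-irrefl; <⇒≱; ≤∧≢⇒<; n≤1+n; +-comm; +-assoc; +-suc;
         +-identityʳ; +-monoʳ-≤; +-monoˡ-≤; +-cancelˡ-≡; +-cancelʳ-≡; m∸n+n≡m; +-0-commutativeMonoid)
open import Algebra.Properties.CommutativeMonoid.Sum +-0-commutativeMonoid
  using (sum-syntax; ∑-comm; ∑-distrib-+; sum-cong-≗)
import Data.Nat.Properties as ℕ
open import Data.Product using (Σ; ∃-syntax; _×_; _,_; proj₁; proj₂)
open import Data.Sum using (_⊎_; inj₁; inj₂)
open import Data.Vec using ([]; _∷_; lookup; tabulate; here; there)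
open import Data.Vec.Properties using (lookup∘tabulate; []=⇒lookup; lookup⇒[]=)
open import Function using (_∘_)
open import Function.Bundles using (_⇔_; mk⇔)
open import Relation.Binary.PropositionalEquality
  using (_≡_; _≢_; refl; sym; trans; cong; cong₂; subst; module ≡-Reasoning)
open import Relation.Nullary using (¬_; Dec; yes; no; does; ¬?; contradiction)
open import Relation.Nullary.Decidable using (dec-true; _×-dec_)
open import Relation.Unary using (Pred; Decidable)

open import Defs

open Transposition

private variable
  m n k : ℕ

-- Counting in finite subsets

∈-tabulate⁺ : {f : Fin n → Bool} {x : Fin n} → f x ≡ true → x ∈ tabulate f
∈-tabulate⁺ {f = f} {x} fx = lookup⇒[]= x (tabulate f) (trans (lookup∘tabulate f x) fx)

∈-tabulate⁻ : {f : Fin n → Bool} {x : Fin n} → x ∈ tabulate f → f x ≡ true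
∈-tabulate⁻ {f = f} {x} x∈ = trans (sym (lookup∘tabulate f x)) ([]=⇒lookup x∈)

subsetOf : ∀ {ℓ} {P : Pred (Fin n) ℓ} → Decidable P → Subset n
subsetOf P? = tabulate (λ x → does (P? x))

module _ {ℓ} {P : Pred (Fin n) ℓ} (P? : Decidable P) where

  ∈-subsetOf⁺ : ∀ {x} → P x → x ∈ subsetOf P?
  ∈-subsetOf⁺ {x} px = ∈-tabulate⁺ (dec-true (P? x) px)

  ∈-subsetOf⁻ : ∀ {x} → x ∈ subsetOf P? → P x
  ∈-subsetOf⁻ {x} x∈ with P? x | ∈-tabulate⁻ {f = λ y → does (P? y)} x∈
  ... | yes px | _ = px

∈-memberships⁺ : {C : Fin k → Subset n} {i : Fin k} {v : Fin n} → v ∈ C i → i ∈ memberships C v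
∈-memberships⁺ v∈ = ∈-tabulate⁺ ([]=⇒lookup v∈)

∈-memberships⁻ : {C : Fin k → Subset n} {i : Fin k} {v : Fin n} → i ∈ memberships C v → v ∈ C i
∈-memberships⁻ {C = C} {i} {v} i∈ = lookup⇒[]= v (C i) (∈-tabulate⁻ i∈)

∣p∣≤1 : ∀ {n} {p : Subset n} → (∀ {x y} → x ∈ p → y ∈ p → x ≡ y) → ∣ p ∣ ≤ 1
∣p∣≤1 {n} {p} unique with nonempty? p
... | yes (x , x∈p) = subst (∣ p ∣ ≤_) (∣⁅x⁆∣≡1 x)
                        (p⊆q⇒∣p∣≤∣q∣ λ y∈p → subst (_∈ ⁅ x ⁆) (unique x∈p y∈p) (x∈⁅x⁆ x))
... | no ¬nonempty = ≤-trans (≤-reflexive (trans (cong ∣_∣ (Empty-unique ¬nonempty)) (∣⊥∣≡0 n))) z≤n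

∣x∷p∣≤1+∣p∣ : ∀ s (p : Subset n) → ∣ s ∷ p ∣ ≤ suc ∣ p ∣
∣x∷p∣≤1+∣p∣ inside  p = ≤-refl
∣x∷p∣≤1+∣p∣ outside p = n≤1+n ∣ p ∣

∣p∣≤1+∣q∣ : (p q : Subset n) (x : Fin n) → (∀ {y} → y ∈ p → y ≢ x → y ∈ q) → ∣ p ∣ ≤ suc ∣ q ∣
∣p∣≤1+∣q∣ (s ∷ p) (r ∷ q) zero p⊆q∪x =
  ≤-trans (∣x∷p∣≤1+∣p∣ s p) (s≤s (≤-trans (p⊆q⇒∣p∣≤∣q∣ λ y∈p → drop-there (p⊆q∪x (there y∈p) λ ())) (∣p∣≤∣x∷p∣ r q)))
∣p∣≤1+∣q∣ (outside ∷ p) (r ∷ q) (suc x) p⊆q∪x =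
  ≤-trans (∣p∣≤1+∣q∣ p q x λ y∈p y≢x → drop-there (p⊆q∪x (there y∈p) (y≢x ∘ suc-injective))) (s≤s (∣p∣≤∣x∷p∣ r q))
∣p∣≤1+∣q∣ (inside ∷ p) (r ∷ q) (suc x) p⊆q∪x with p⊆q∪x here (λ ())
... | here = s≤s (∣p∣≤1+∣q∣ p q x λ y∈p y≢x → drop-there (p⊆q∪x (there y∈p) (y≢x ∘ suc-injective)))

∣p∣≤2 : {p : Subset n} {x y : Fin n} → (∀ {z} → z ∈ p → z ≡ x ⊎ z ≡ y) → ∣ p ∣ ≤ 2
∣p∣≤2 {p = p} {x} {y} p⊆xy = subst (λ c → ∣ p ∣ ≤ suc c) (∣⁅x⁆∣≡1 y) (∣p∣≤1+∣q∣ p ⁅ y ⁆ x y-if-not-x)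
  where
  y-if-not-x : ∀ {z} → z ∈ p → z ≢ x → z ∈ ⁅ y ⁆
  y-if-not-x z∈p z≢x with p⊆xy z∈p
  ... | inj₁ z≡x = contradiction z≡x z≢x
  ... | inj₂ refl = x∈⁅x⁆ y

1≤∣p∣ : {p : Subset n} {x : Fin n} → x ∈ p → 1 ≤ ∣ p ∣
1≤∣p∣ x∈p = ≤-trans (s≤s z≤n) (x∈p⇒∣p-x∣<∣p∣ x∈p)

2≤∣p∣ : {p : Subset n} {x y : Fin n} → x ∈ p → y ∈ p → x ≢ y → 2 ≤ ∣ p ∣
2≤∣p∣ x∈p y∈p x≢y = ≤-trans (s≤s (1≤∣p∣ (x∈p∧x≢y⇒x∈p-y y∈p (x≢y ∘ sym)))) (x∈p⇒∣p-x∣<∣p∣ x∈p)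

3≤∣p∣ : {p : Subset n} {x y z : Fin n} → x ∈ p → y ∈ p → z ∈ p → x ≢ y → x ≢ z → y ≢ z → 3 ≤ ∣ p ∣
3≤∣p∣ x∈p y∈p z∈p x≢y x≢z y≢z =
  ≤-trans (s≤s (2≤∣p∣ (x∈p∧x≢y⇒x∈p-y y∈p (x≢y ∘ sym)) (x∈p∧x≢y⇒x∈p-y z∈p (x≢z ∘ sym)) y≢z)) (x∈p⇒∣p-x∣<∣p∣ x∈p)

indicator : Bool → ℕ
indicator true  = 1
indicator false = 0

∣p∣≡∑indicator : (p : Subset n) → ∣ p ∣ ≡ ∑[ x < n ] indicator (lookup p x)
∣p∣≡∑indicator []            = refl
∣p∣≡∑indicator (inside ∷ p)  = cong suc (∣p∣≡∑indicator p)
∣p∣≡∑indicator (outside ∷ p) = ∣p∣≡∑indicator p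

∑∣C∣≡∑∣memberships∣ : (C : Fin k → Subset n) →
  ∑[ i < k ] ∣ C i ∣ ≡ ∑[ v < n ] ∣ memberships C v ∣
∑∣C∣≡∑∣memberships∣ {k} {n} C = begin
  ∑[ i < k ] ∣ C i ∣                                  ≡⟨ sum-cong-≗ (∣p∣≡∑indicator ∘ C) ⟩
  ∑[ i < k ] ∑[ v < n ] indicator (lookup (C i) v)    ≡⟨ ∑-comm (λ i v → indicator (lookup (C i) v)) ⟩
  ∑[ v < n ] ∑[ i < k ] indicator (lookup (C i) v)    ≡⟨ sum-cong-≗ (sym ∘ ∣memberships∣≡∑) ⟩
  ∑[ v < n ] ∣ memberships C v ∣                      ∎
  where
  open ≡-Reasoning
  ∣memberships∣≡∑ : ∀ v → ∣ memberships C v ∣ ≡ ∑[ i < k ] indicator (lookup (C i) v)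
  ∣memberships∣≡∑ v = trans (∣p∣≡∑indicator (memberships C v))
                            (sum-cong-≗ (cong indicator ∘ lookup∘tabulate (λ i → lookup (C i) v)))

∑[2]≡n+[n+2] : ∀ n → ∑[ i < suc n ] 2 ≡ n + suc (suc n)
∑[2]≡n+[n+2] zero    = refl
∑[2]≡n+[n+2] (suc n) = trans (cong (2 +_) (∑[2]≡n+[n+2] n)) (cong suc (sym (+-suc n (suc (suc n)))))

∑[f∸1]+k≡∑f : (f : Fin k → ℕ) → (∀ i → 1 ≤ f i) → ∑[ i < k ] (f i ∸ 1) + k ≡ ∑[ i < k ] f i
∑[f∸1]+k≡∑f {zero}  f 1≤f = refl
∑[f∸1]+k≡∑f {suc k} f 1≤f = begin
  f zero ∸ 1 + ∑[ i < k ] (f (suc i) ∸ 1) + suc k   ≡⟨ +-suc _ k ⟩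
  suc (f zero ∸ 1 + ∑[ i < k ] (f (suc i) ∸ 1) + k) ≡⟨ cong suc (+-assoc (f zero ∸ 1) _ k) ⟩
  suc (f zero ∸ 1) + (∑[ i < k ] (f (suc i) ∸ 1) + k) ≡⟨ cong₂ _+_ (trans (+-comm 1 _) (m∸n+n≡m (1≤f zero)))
                                                                      (∑[f∸1]+k≡∑f (f ∘ suc) (1≤f ∘ suc)) ⟩
  f zero + ∑[ i < k ] f (suc i)                     ∎
  where open ≡-Reasoning

sum-map-allFin : (f : Fin k → ℕ) → sum (map f (allFin k)) ≡ ∑[ i < k ] f i
sum-map-allFin f = trans (cong sum (map-tabulate (λ i → i) f)) (sum-tabulate f)
  where
  sum-tabulate : ∀ {k} (g : Fin k → ℕ) → sum (List.tabulate g) ≡ ∑[ i < k ] g i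
  sum-tabulate {zero}  g = refl
  sum-tabulate {suc k} g = cong (g zero +_) (sum-tabulate (g ∘ suc))

∑[∣C∣∸1]+k≡∑∣memberships∣ : (C : Fin k → Subset n) → (∀ i → Nonempty (C i)) →
  ∑[ i < k ] (∣ C i ∣ ∸ 1) + k ≡ ∑[ v < n ] ∣ memberships C v ∣
∑[∣C∣∸1]+k≡∑∣memberships∣ C nonempty =
  trans (∑[f∸1]+k≡∑f (∣_∣ ∘ C) (λ i → 1≤∣p∣ (proj₂ (nonempty i)))) (∑∣C∣≡∑∣memberships∣ C)

select : (p : Subset n) → Fin ∣ p ∣ → Fin n
select (inside  ∷ p) zero    = zero
select (inside  ∷ p) (suc j) = suc (select p j)
select (outside ∷ p) j       = suc (select p j)

select∈ : (p : Subset n) (j : Fin ∣ p ∣) → select p j ∈ p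
select∈ (inside  ∷ p) zero    = here
select∈ (inside  ∷ p) (suc j) = there (select∈ p j)
select∈ (outside ∷ p) j       = there (select∈ p j)

select-injective : (p : Subset n) {i j : Fin ∣ p ∣} → select p i ≡ select p j → i ≡ j
select-injective (inside  ∷ p) {zero}  {zero}  _ = refl
select-injective (inside  ∷ p) {suc i} {suc j} e = cong suc (select-injective p (suc-injective e))
select-injective (outside ∷ p)                 e = select-injective p (suc-injective e)

rank : (p : Subset n) {x : Fin n} → x ∈ p → Fin ∣ p ∣
rank (inside  ∷ p) here        = zero
rank (inside  ∷ p) (there x∈p) = suc (rank p x∈p)
rank (outside ∷ p) (there x∈p) = rank p x∈p

select-rank : (p : Subset n) {x : Fin n} (x∈p : x ∈ p) → select p (rank p x∈p) ≡ x
select-rank (inside  ∷ p) here        = refl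
select-rank (inside  ∷ p) (there x∈p) = cong suc (select-rank p x∈p)
select-rank (outside ∷ p) (there x∈p) = cong suc (select-rank p x∈p)

-- Transpositions

private
  T : Fin m → Fin m → Fin m → Fin m
  T = PC.transpose

transpose-first : (i j : Fin m) → PC.transpose i j i ≡ j
transpose-first i j with i ≟ i
... | yes _   = refl
... | no i≢i = contradiction refl i≢i

transpose-second : (i j : Fin m) → PC.transpose i j j ≡ i
transpose-second i j with j ≟ i
... | yes j≡i = j≡i
... | no _ with j ≟ j
...   | yes _   = refl
...   | no j≢j = contradiction refl j≢j

transpose-fixes : ∀ {i j k : Fin m} → k ≢ i → k ≢ j → PC.transpose i j k ≡ k
transpose-fixes {i = i} {j} {k} k≢i k≢j with k ≟ i
... | yes k≡i = contradiction k≡i k≢i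
... | no _ with k ≟ j
...   | yes k≡j = contradiction k≡j k≢j
...   | no _    = refl

transpose-self : (i k : Fin m) → PC.transpose i i k ≡ k
transpose-self i k = by-cases (k ≟ i)
  where
  by-cases : Dec (k ≡ i) → T i i k ≡ k
  by-cases (yes refl) = transpose-first k k
  by-cases (no k≢i)   = transpose-fixes k≢i k≢i

transpose-comm : (i j k : Fin m) → PC.transpose i j k ≡ PC.transpose j i k
transpose-comm i j k = by-cases (k ≟ i) (k ≟ j)
  where
  by-cases : Dec (k ≡ i) → Dec (k ≡ j) → T i j k ≡ T j i k
  by-cases (yes refl) _          = trans (transpose-first k j) (sym (transpose-second j k))
  by-cases (no _)     (yes refl) = trans (transpose-second i k) (sym (transpose-first k i))
  by-cases (no k≢i)   (no k≢j)   = trans (transpose-fixes k≢i k≢j) (sym (transpose-fixes k≢j k≢i))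

transpose-involutive : (i j k : Fin m) → PC.transpose i j (PC.transpose i j k) ≡ k
transpose-involutive i j k = trans (cong (PC.transpose i j) (transpose-comm i j k)) (PC.transpose-inverse i j)

transpose-conjugate : ∀ {p q r : Fin m} → p ≢ q → p ≢ r → q ≢ r → ∀ x →
  PC.transpose q r (PC.transpose p q (PC.transpose q r x)) ≡ PC.transpose p r x
transpose-conjugate {p = p} {q} {r} p≢q p≢r q≢r x = by-cases (x ≟ p) (x ≟ q) (x ≟ r)
  where
  open ≡-Reasoning
  by-cases : Dec (x ≡ p) → Dec (x ≡ q) → Dec (x ≡ r) → T q r (T p q (T q r x)) ≡ T p r x
  by-cases (yes refl) _ _ = begin
    T q r (T x q (T q r x)) ≡⟨ cong (T q r ∘ T x q) (transpose-fixes p≢q p≢r) ⟩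
    T q r (T x q x)         ≡⟨ cong (T q r) (transpose-first x q) ⟩
    T q r q                 ≡⟨ transpose-first q r ⟩
    r                       ≡⟨ sym (transpose-first x r) ⟩
    T x r x                 ∎
  by-cases (no _) (yes refl) _ = begin
    T x r (T p x (T x r x)) ≡⟨ cong (T x r ∘ T p x) (transpose-first x r) ⟩
    T x r (T p x r)         ≡⟨ cong (T x r) (transpose-fixes (p≢r ∘ sym) (q≢r ∘ sym)) ⟩
    T x r r                 ≡⟨ transpose-second x r ⟩
    x                       ≡⟨ sym (transpose-fixes (p≢q ∘ sym) q≢r) ⟩
    T p r x                 ∎
  by-cases (no _) (no _) (yes refl) = begin
    T q x (T p q (T q x x)) ≡⟨ cong (T q x ∘ T p q) (transpose-second q x) ⟩
    T q x (T p q q)         ≡⟨ cong (T q x) (transpose-second p q) ⟩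
    T q x p                 ≡⟨ transpose-fixes p≢q p≢r ⟩
    p                       ≡⟨ sym (transpose-second p x) ⟩
    T p x x                 ∎
  by-cases (no x≢p) (no x≢q) (no x≢r) = begin
    T q r (T p q (T q r x)) ≡⟨ cong (T q r ∘ T p q) (transpose-fixes x≢q x≢r) ⟩
    T q r (T p q x)         ≡⟨ cong (T q r) (transpose-fixes x≢p x≢q) ⟩
    T q r x                 ≡⟨ transpose-fixes x≢q x≢r ⟩
    x                       ≡⟨ sym (transpose-fixes x≢p x≢r) ⟩
    T p r x                 ∎

swap : Transposition m → Fin m → Fin m
swap s x = toPerm s ⟨$⟩ʳ x

infix 4 _∈ₜ_ _∈ₜ?_ _⊆ₜ_

_∈ₜ_ : Fin m → Transposition m → Set
x ∈ₜ s = x ≡ a s ⊎ x ≡ b s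

_∈ₜ?_ : (x : Fin m) (s : Transposition m) → Dec (x ∈ₜ s)
x ∈ₜ? s with x ≟ a s | x ≟ b s
... | yes x≡a | _       = yes (inj₁ x≡a)
... | no _    | yes x≡b = yes (inj₂ x≡b)
... | no x≢a  | no x≢b  = no λ { (inj₁ x≡a) → x≢a x≡a ; (inj₂ x≡b) → x≢b x≡b }

-- For transpositions, inclusion of supports is equality of supports.
_⊆ₜ_ : Transposition m → Transposition m → Set
s ⊆ₜ t = a s ∈ₜ t × b s ∈ₜ t

∈ₜ-⊆ₜ : ∀ (s : Transposition m) {t x} → x ∈ₜ s → s ⊆ₜ t → x ∈ₜ t
∈ₜ-⊆ₜ _ (inj₁ refl) (a∈t , _) = a∈t
∈ₜ-⊆ₜ _ (inj₂ refl) (_ , b∈t) = b∈t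

∈ₜ-two : ∀ (s : Transposition m) {x y z} → x ∈ₜ s → y ∈ₜ s → x ≢ y → z ∈ₜ s → z ≡ x ⊎ z ≡ y
∈ₜ-two _ (inj₁ refl) (inj₁ refl) x≢y _ = contradiction refl x≢y
∈ₜ-two _ (inj₂ refl) (inj₂ refl) x≢y _ = contradiction refl x≢y
∈ₜ-two _ (inj₁ refl) (inj₂ refl) _ z∈s = z∈s
∈ₜ-two _ (inj₂ refl) (inj₁ refl) _ (inj₁ z≡a) = inj₂ z≡a
∈ₜ-two _ (inj₂ refl) (inj₁ refl) _ (inj₂ z≡b) = inj₁ z≡b

two-points⇒⊆ₜ : ∀ (s t : Transposition m) {x y} → x ∈ₜ s → y ∈ₜ s → x ≢ y → x ∈ₜ t → y ∈ₜ t → s ⊆ₜ t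
two-points⇒⊆ₜ s t x∈s y∈s x≢y x∈t y∈t = point∈t (inj₁ refl) , point∈t (inj₂ refl)
  where
  point∈t : ∀ {z} → z ∈ₜ s → z ∈ₜ t
  point∈t z∈s with ∈ₜ-two s x∈s y∈s x≢y z∈s
  ... | inj₁ refl = x∈t
  ... | inj₂ refl = y∈t

swap-∈ : ∀ (s : Transposition m) {x} → x ∈ₜ s → swap s x ∈ₜ s
swap-∈ s (inj₁ refl) = inj₂ (transpose-first (a s) (b s))
swap-∈ s (inj₂ refl) = inj₁ (transpose-second (a s) (b s))

swap-moves : ∀ (s : Transposition m) {x} → x ∈ₜ s → swap s x ≢ x
swap-moves s (inj₁ refl) e = a≢b s (trans (sym e) (transpose-first (a s) (b s)))
swap-moves s (inj₂ refl) e = a≢b s (trans (sym (transpose-second (a s) (b s))) e)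

swap-∉ : ∀ (s : Transposition m) {x} → ¬ x ∈ₜ s → swap s x ≡ x
swap-∉ s x∉s = transpose-fixes (x∉s ∘ inj₁) (x∉s ∘ inj₂)

disjoint⇒commute : ∀ (s t : Transposition m) → (∀ {x} → x ∈ₜ s → ¬ x ∈ₜ t) → Commute (toPerm s) (toPerm t)
disjoint⇒commute s t disjoint x with x ∈ₜ? s | x ∈ₜ? t
... | yes x∈s | _ = begin
  swap t (swap s x) ≡⟨ swap-∉ t (disjoint (swap-∈ s x∈s)) ⟩
  swap s x          ≡⟨ cong (swap s) (sym (swap-∉ t (disjoint x∈s))) ⟩
  swap s (swap t x) ∎
  where open ≡-Reasoning
... | no x∉s | yes x∈t = begin
  swap t (swap s x) ≡⟨ cong (swap t) (swap-∉ s x∉s) ⟩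
  swap t x          ≡⟨ sym (swap-∉ s λ tx∈s → disjoint tx∈s (swap-∈ t x∈t)) ⟩
  swap s (swap t x) ∎
  where open ≡-Reasoning
... | no x∉s | no x∉t = begin
  swap t (swap s x) ≡⟨ cong (swap t) (swap-∉ s x∉s) ⟩
  swap t x          ≡⟨ swap-∉ t x∉t ⟩
  x                 ≡⟨ sym (swap-∉ s x∉s) ⟩
  swap s x          ≡⟨ cong (swap s) (sym (swap-∉ t x∉t)) ⟩
  swap s (swap t x) ∎
  where open ≡-Reasoning

-- At the shared point p the two products give the other point of s and the other point of t.
shared⇒¬commute : ∀ {m} (s t : Transposition m) {p} → p ∈ₜ s → p ∈ₜ t → ¬ s ⊆ₜ t → ¬ Commute (toPerm s) (toPerm t)
shared⇒¬commute {m} s t {p} p∈s p∈t s⊈t commute = q∉t (subst (_∈ₜ t) (sym q≡r) (swap-∈ t p∈t))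
  where
  q r : Fin m
  q = swap s p
  r = swap t p
  q∉t : ¬ q ∈ₜ t
  q∉t q∈t = s⊈t (two-points⇒⊆ₜ s t p∈s (swap-∈ s p∈s) (swap-moves s p∈s ∘ sym) p∈t q∈t)
  r∉s : ¬ r ∈ₜ s
  r∉s r∈s with ∈ₜ-two s p∈s (swap-∈ s p∈s) (swap-moves s p∈s ∘ sym) r∈s
  ... | inj₁ r≡p = swap-moves t p∈t r≡p
  ... | inj₂ r≡q = q∉t (subst (_∈ₜ t) r≡q (swap-∈ t p∈t))
  q≡r : q ≡ r
  q≡r = begin
    q          ≡⟨ sym (swap-∉ t q∉t) ⟩
    swap t q   ≡⟨ commute p ⟩
    swap s r   ≡⟨ swap-∉ s r∉s ⟩
    r          ∎
    where open ≡-Reasoning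

¬commute⇒shared : ∀ (s t : Transposition m) → ¬ Commute (toPerm s) (toPerm t) → ∃[ p ] (p ∈ₜ s × p ∈ₜ t)
¬commute⇒shared s t ¬commute with a s ∈ₜ? t | b s ∈ₜ? t
... | yes a∈t | _       = a s , inj₁ refl , a∈t
... | no _    | yes b∈t = b s , inj₂ refl , b∈t
... | no a∉t  | no b∉t  = contradiction (disjoint⇒commute s t λ { (inj₁ refl) → a∉t ; (inj₂ refl) → b∉t }) ¬commute

transpose≈toPerm : ∀ (s : Transposition m) {x y} → x ∈ₜ s → y ∈ₜ s → x ≢ y → transpose x y ≈ toPerm s
transpose≈toPerm s (inj₁ refl) (inj₁ refl) x≢y = contradiction refl x≢y
transpose≈toPerm s (inj₁ refl) (inj₂ refl) _   _ = refl
transpose≈toPerm s (inj₂ refl) (inj₁ refl) _   z = transpose-comm (b s) (a s) z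
transpose≈toPerm s (inj₂ refl) (inj₂ refl) x≢y = contradiction refl x≢y

-- Linked points and generation

data Linked (t : Fin n → Transposition m) (p : Fin m) : Fin m → Set where
  here : Linked t p p
  step : ∀ {q r} → Linked t p q → (i : Fin n) → q ∈ₜ t i → r ∈ₜ t i → Linked t p r

AllLinked : (Fin n → Transposition m) → Set
AllLinked t = ∀ p q → Linked t p q

module _ {t : Fin n → Transposition m} where

  linked-trans : ∀ {p q r} → Linked t p q → Linked t q r → Linked t p r
  linked-trans p~q here                = p~q
  linked-trans p~q (step q~r i r∈ s∈) = step (linked-trans p~q q~r) i r∈ s∈

  linked-sym : ∀ {p q} → Linked t p q → Linked t q p
  linked-sym here                 = here
  linked-sym (step p~q i q∈ r∈) = linked-trans (step here i r∈ q∈) (linked-sym p~q)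

  linked-swap : ∀ {p x} (i : Fin n) → Linked t p x → Linked t p (swap (t i) x)
  linked-swap {x = x} i p~x with x ∈ₜ? t i
  ... | yes x∈ = step p~x i x∈ (swap-∈ (t i) x∈)
  ... | no x∉  = subst (Linked t _) (sym (swap-∉ (t i) x∉)) p~x

linked-mono : {t : Fin n → Transposition m} {t′ : Fin k → Transposition m} →
  (∀ i → ∃[ j ] (t i ⊆ₜ t′ j)) → ∀ {p q} → Linked t p q → Linked t′ p q
linked-mono covered here = here
linked-mono {t = t} {t′} covered (step p~q i q∈ r∈) with covered i
... | j , ti⊆t′j = step (linked-mono covered p~q) j (∈ₜ-⊆ₜ (t i) {t′ j} q∈ ti⊆t′j) (∈ₜ-⊆ₜ (t i) {t′ j} r∈ ti⊆t′j)

module _ (t : Fin n → Transposition m) where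

  word : List (Fin n) → Permutation′ m
  word w = prod (map (λ i → toPerm (t i)) w)

  linked-word : ∀ {p x} (w : List (Fin n)) → Linked t p x → Linked t p (word w ⟨$⟩ʳ x)
  linked-word []      p~x = p~x
  linked-word (i ∷ w) p~x = linked-word w (linked-swap i p~x)

  generates⇒linked : Generates t → AllLinked t
  generates⇒linked generates p q with generates (transpose p q)
  ... | w , τ≈w = subst (Linked t p) (trans (sym (τ≈w p)) (transpose-first p q)) (linked-word w here)

  record Expressible (π : Permutation′ m) : Set where
    constructor expressed
    field
      letters : List (Fin n)
      π≈word  : π ≈ word letters

  word-++ : ∀ w₁ w₂ x → word (w₁ ++ w₂) ⟨$⟩ʳ x ≡ word w₂ ⟨$⟩ʳ (word w₁ ⟨$⟩ʳ x)
  word-++ []       w₂ x = refl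
  word-++ (i ∷ w₁) w₂ x = word-++ w₁ w₂ (swap (t i) x)

  expressible-≈ : ∀ {π ρ} → π ≈ ρ → Expressible ρ → Expressible π
  expressible-≈ π≈ρ (expressed w ρ≈w) = expressed w λ x → trans (π≈ρ x) (ρ≈w x)

  expressible-id : ∀ {π} → π ≈ id → Expressible π
  expressible-id π≈id = expressed [] π≈id

  expressible-∘ : ∀ {π ρ} → Expressible π → Expressible ρ → Expressible (π ∘ₚ ρ)
  expressible-∘ {π} {ρ} (expressed w₁ π≈w₁) (expressed w₂ ρ≈w₂) =
    expressed (w₁ ++ w₂) λ x → trans (cong (ρ ⟨$⟩ʳ_) (π≈w₁ x)) (trans (ρ≈w₂ _) (sym (word-++ w₁ w₂ x)))

  expressible-generator : ∀ i → Expressible (toPerm (t i))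
  expressible-generator i = expressed (i ∷ []) λ _ → refl

  -- Along the last step q — r of the chain, (p r) = (q r)(p q)(q r).
  linked⇒transpose-expressible : ∀ {p r} → Linked t p r → Expressible (transpose p r)
  linked⇒transpose-expressible {p} here = expressible-id (transpose-self p)
  linked⇒transpose-expressible {p} {r} (step {q = q} p~q i q∈ r∈) = by-cases (q ≟ r) (p ≟ r) (p ≟ q)
    where
    generator : q ≢ r → Expressible (transpose q r)
    generator q≢r = expressible-≈ (transpose≈toPerm (t i) q∈ r∈ q≢r) (expressible-generator i)
    by-cases : Dec (q ≡ r) → Dec (p ≡ r) → Dec (p ≡ q) → Expressible (transpose p r)
    by-cases (yes refl) _          _          = linked⇒transpose-expressible p~q
    by-cases (no _)     (yes refl) _          = expressible-id (transpose-self p)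
    by-cases (no q≢r)   (no _)     (yes refl) = generator q≢r
    by-cases (no q≢r)   (no p≢r)   (no p≢q)   =
      expressible-≈ (sym ∘ transpose-conjugate p≢q p≢r q≢r)
        (expressible-∘ (generator q≢r) (expressible-∘ (linked⇒transpose-expressible p~q) (generator q≢r)))

  module _ (linked : AllLinked t) where

    expressible-fixing-above : ∀ b → b ≤ m → ∀ π → (∀ x → b ≤ toℕ x → π ⟨$⟩ʳ x ≡ x) → Expressible π
    expressible-fixing-above zero    _   π fixes = expressible-id (λ x → fixes x z≤n)
    expressible-fixing-above (suc b) b<m π fixes =
      expressible-≈ (λ x → sym (transpose-involutive y xb (π ⟨$⟩ʳ x)))
        (expressible-∘ (expressible-fixing-above b (≤-trans (n≤1+n b) b<m) π′ π′-fixes)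
                       (linked⇒transpose-expressible (linked y xb)))
      where
      xb y : Fin m
      xb = fromℕ< b<m
      y  = π ⟨$⟩ʳ xb
      τ π′ : Permutation′ m
      τ  = transpose y xb
      π′ = π ∘ₚ τ
      π′-fixes : ∀ x → b ≤ toℕ x → π′ ⟨$⟩ʳ x ≡ x
      π′-fixes x b≤x with toℕ x ℕ.≟ b
      ... | yes x≡b rewrite toℕ-injective (trans x≡b (sym (toℕ-fromℕ< b<m))) = transpose-first y xb
      ... | no x≢b = trans (cong (PC.transpose y xb) πx≡x) (transpose-fixes x≢y x≢xb)
        where
        πx≡x : π ⟨$⟩ʳ x ≡ x
        πx≡x = fixes x (≤∧≢⇒< b≤x (x≢b ∘ sym))
        x≢xb : x ≢ xb
        x≢xb x≡xb = x≢b (trans (cong toℕ x≡xb) (toℕ-fromℕ< b<m))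
        x≢y : x ≢ y
        x≢y x≡y = x≢xb (trans (sym (inverseˡ π)) (trans (cong (π ⟨$⟩ˡ_) (trans πx≡x x≡y)) (inverseˡ π)))

    linked⇒generates : Generates t
    linked⇒generates π = letters , π≈word
      where open Expressible (expressible-fixing-above m ≤-refl π λ x m≤x → contradiction m≤x (<⇒≱ (toℕ<n x)))

fixedPoints : (Fin m → Fin m) → Subset m
fixedPoints f = subsetOf (λ x → f x ≟ x)

redirect : Fin m → Fin m → Fin m → Fin m
redirect from to x with x ≟ from
... | yes _ = to
... | no _  = x

redirect-from : (from to : Fin m) → redirect from to from ≡ to
redirect-from from to with from ≟ from
... | yes _         = refl
... | no from≢from = contradiction refl from≢from

redirect-other : ∀ {from x} (to : Fin m) → x ≢ from → redirect from to x ≡ x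
redirect-other {from = from} {x} to x≢from with x ≟ from
... | yes x≡from = contradiction x≡from x≢from
... | no _       = refl

-- Union-find: merging the two classes joined by each transposition in turn, every merge removes at most one root.
merging-labelling : (t : Fin n → Transposition m) →
  ∃[ f ] ((∀ i → f (a (t i)) ≡ f (b (t i))) × m ≤ ∣ fixedPoints f ∣ + n)
merging-labelling {zero} {m} t = (λ x → x) , (λ ()) , subst (m ≤_) (sym (+-identityʳ _)) m≤∣fix∣
  where
  m≤∣fix∣ : m ≤ ∣ fixedPoints {m} (λ x → x) ∣
  m≤∣fix∣ = begin
    m                                ≡⟨ ∣⊤∣≡n m ⟨
    ∣ ⊤ {m} ∣                        ≤⟨ p⊆q⇒∣p∣≤∣q∣ {m} {p = ⊤} {q = fixedPoints (λ x → x)}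
                                                       (λ _ → ∈-subsetOf⁺ (λ y → y ≟ y) refl) ⟩
    ∣ fixedPoints {m} (λ x → x) ∣    ∎
    where open ℕ.≤-Reasoning
merging-labelling {suc n} {m} t with merging-labelling (t ∘ suc)
... | f , f-resp , m≤fix+n with f (a (t zero)) ≟ f (b (t zero))
...   | yes fa≡fb = f , (λ { zero → fa≡fb ; (suc i) → f-resp i }) , ≤-trans m≤fix+n (+-monoʳ-≤ _ (n≤1+n n))
...   | no fa≢fb  = g , g-resp , m≤fix+1+n
  where
  merge g : Fin m → Fin m
  merge = redirect (f (b (t zero))) (f (a (t zero)))
  g = merge ∘ f
  g-resp : ∀ i → g (a (t i)) ≡ g (b (t i))
  g-resp zero    = trans (redirect-other (f (a (t zero))) fa≢fb) (sym (redirect-from (f (b (t zero))) _))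
  g-resp (suc i) = cong merge (f-resp i)
  fixed-stays-fixed : ∀ {x} → x ∈ fixedPoints f → x ≢ f (b (t zero)) → x ∈ fixedPoints g
  fixed-stays-fixed {x} x∈fix x≢fb = ∈-subsetOf⁺ (λ y → g y ≟ y)
    (trans (cong merge (∈-subsetOf⁻ (λ y → f y ≟ y) x∈fix)) (redirect-other _ x≢fb))
  m≤fix+1+n : m ≤ ∣ fixedPoints g ∣ + suc n
  m≤fix+1+n = begin
    m                         ≤⟨ m≤fix+n ⟩
    ∣ fixedPoints f ∣ + n     ≤⟨ +-monoˡ-≤ n (∣p∣≤1+∣q∣ (fixedPoints f) (fixedPoints g) _ fixed-stays-fixed) ⟩
    suc ∣ fixedPoints g ∣ + n ≡⟨ +-suc _ n ⟨
    ∣ fixedPoints g ∣ + suc n ∎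
    where open ℕ.≤-Reasoning

linked⇒m≤1+n : (t : Fin n → Transposition m) → AllLinked t → m ≤ suc n
linked⇒m≤1+n {n} t linked with merging-labelling t
... | f , f-resp , m≤fix+n = ≤-trans m≤fix+n (+-monoˡ-≤ n (∣p∣≤1 {p = fixedPoints f} fixed-unique))
  where
  f-const : ∀ {p q} → Linked t p q → f p ≡ f q
  f-const here                   = refl
  f-const (step p~q i q∈ r∈) = trans (f-const p~q) (trans (endpoint q∈) (sym (endpoint r∈)))
    where
    endpoint : ∀ {x} → x ∈ₜ t i → f x ≡ f (a (t i))
    endpoint (inj₁ refl) = refl
    endpoint (inj₂ refl) = sym (f-resp i)
  fixed-unique : ∀ {x y} → x ∈ fixedPoints f → y ∈ fixedPoints f → x ≡ y
  fixed-unique {x} {y} x∈ y∈ = trans (sym (∈-subsetOf⁻ (λ z → f z ≟ z) x∈))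
                                 (trans (f-const (linked x y)) (∈-subsetOf⁻ (λ z → f z ≟ z) y∈))

-- From a Carter labelling to a clique decomposition

AdjacentIffNoncommuting : Graph n → (Fin n → Transposition m) → Set
AdjacentIffNoncommuting Γ t =
  ∀ u v → u ≢ v → (adj Γ u v ≡ true → ¬ Commute (toPerm (t u)) (toPerm (t v)))
                × (¬ Commute (toPerm (t u)) (toPerm (t v)) → adj Γ u v ≡ true)

CarterLabelling : Graph n → (Fin n → Transposition m) → Set
CarterLabelling Γ t = Generates t × AdjacentIffNoncommuting Γ t

reach-snoc : ∀ {Γ : Graph n} {u v w} → Reach Γ u v → adj Γ v w ≡ true → Reach Γ u w
reach-snoc here           v~w = step v~w here
reach-snoc (step u~x x⇝v) v~w = step u~x (reach-snoc x⇝v v~w)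

module CarterToCliques {n} {Γ : Graph (suc n)} {t : Fin (suc n) → Transposition (suc (suc n))}
                       (generates : Generates t) (adjacency : AdjacentIffNoncommuting Γ t) where

  linked : AllLinked t
  linked = generates⇒linked t generates

  -- Otherwise the remaining n transpositions would still link all n + 2 points.
  supports-distinct : ∀ {u v} → u ≢ v → ¬ t u ⊆ₜ t v
  supports-distinct {u} {v} u≢v tu⊆tv =
    <-irrefl refl (linked⇒m≤1+n (t ∘ punchIn u) λ p q → linked-mono replaced (linked p q))
    where
    replaced : ∀ i → ∃[ j ] (t i ⊆ₜ t (punchIn u j))
    replaced i with i ≟ u
    ... | yes refl = punchOut u≢v , subst (λ w → t u ⊆ₜ t w) (sym (punchIn-punchOut u≢v)) tu⊆tv
    ... | no i≢u   = punchOut (i≢u ∘ sym) ,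
                     subst (λ w → t i ⊆ₜ t w) (sym (punchIn-punchOut (i≢u ∘ sym))) (inj₁ refl , inj₂ refl)

  shared⇒adjacent : ∀ {u v p} → u ≢ v → p ∈ₜ t u → p ∈ₜ t v → adj Γ u v ≡ true
  shared⇒adjacent {u} {v} u≢v p∈u p∈v =
    proj₂ (adjacency u v u≢v) (shared⇒¬commute (t u) (t v) p∈u p∈v (supports-distinct u≢v))

  adjacent⇒shared : ∀ {u v} → u ≢ v → adj Γ u v ≡ true → ∃[ p ] (p ∈ₜ t u × p ∈ₜ t v)
  adjacent⇒shared {u} {v} u≢v u~v = ¬commute⇒shared (t u) (t v) (proj₁ (adjacency u v u≢v) u~v)

  each-point-used : ∀ p → ∃[ v ] (p ∈ₜ t v)
  each-point-used p with linked (a (t zero)) p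
  ... | here           = zero , inj₁ refl
  ... | step _ v _ p∈v = v , p∈v

  reach-shared : ∀ {u w v p} → Reach Γ u w → p ∈ₜ t w → p ∈ₜ t v → Reach Γ u v
  reach-shared {w = w} {v} u⇝w p∈w p∈v with w ≟ v
  ... | yes refl = u⇝w
  ... | no w≢v   = reach-snoc u⇝w (shared⇒adjacent w≢v p∈w p∈v)

  connected : Connected Γ
  connected u v with reaching (linked (a (t u)) (a (t v)))
    where
    reaching : ∀ {p} → Linked t (a (t u)) p → ∃[ w ] (p ∈ₜ t w × Reach Γ u w)
    reaching here = u , inj₁ refl , here
    reaching (step p~q i q∈i r∈i) with reaching p~q
    ... | w , q∈w , u⇝w = i , r∈i , reach-shared u⇝w q∈w q∈i
  ... | w , av∈w , u⇝w = reach-shared u⇝w av∈w (inj₁ refl)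

  cliques : Fin (suc (suc n)) → Subset (suc n)
  cliques p = subsetOf (λ v → p ∈ₜ? t v)

  ∈-cliques⁺ : ∀ {p v} → p ∈ₜ t v → v ∈ cliques p
  ∈-cliques⁺ {p} = ∈-subsetOf⁺ (λ v → p ∈ₜ? t v)

  ∈-cliques⁻ : ∀ {p v} → v ∈ cliques p → p ∈ₜ t v
  ∈-cliques⁻ {p} = ∈-subsetOf⁻ (λ v → p ∈ₜ? t v)

  union : IsUnionOfCliques Γ cliques
  union = (λ v → a (t v) , ∈-cliques⁺ (inj₁ refl)) , λ u v u≢v →
    (λ u~v → let (p , p∈u , p∈v) = adjacent⇒shared u≢v u~v in p , ∈-cliques⁺ p∈u , ∈-cliques⁺ p∈v) ,
    (λ (p , u∈ , v∈) → shared⇒adjacent u≢v (∈-cliques⁻ {p} u∈) (∈-cliques⁻ {p} v∈))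

  nonempty : ∀ p → Nonempty (cliques p)
  nonempty p = let (v , p∈v) = each-point-used p in v , ∈-cliques⁺ p∈v

  cliques-meet-once : ∀ p q → p ≢ q → ∣ cliques p ∩ cliques q ∣ ≤ 1
  cliques-meet-once p q p≢q = ∣p∣≤1 same-vertex
    where
    same-vertex : ∀ {x y} → x ∈ cliques p ∩ cliques q → y ∈ cliques p ∩ cliques q → x ≡ y
    same-vertex {x} {y} x∈ y∈ with x ≟ y | x∈p∩q⁻ (cliques p) (cliques q) x∈ | x∈p∩q⁻ (cliques p) (cliques q) y∈
    ... | yes x≡y | _ | _ = x≡y
    ... | no x≢y | p∈x , q∈x | p∈y , q∈y = contradiction
      (two-points⇒⊆ₜ (t x) (t y) (∈-cliques⁻ p∈x) (∈-cliques⁻ q∈x) p≢q (∈-cliques⁻ p∈y) (∈-cliques⁻ q∈y))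
      (supports-distinct x≢y)

  ∣memberships∣≡2 : ∀ v → ∣ memberships cliques v ∣ ≡ 2
  ∣memberships∣≡2 v = ≤-antisym (∣p∣≤2 λ {p} → ∈-cliques⁻ {p} ∘ ∈-memberships⁻ {C = cliques} {v = v})
    (2≤∣p∣ (∈-memberships⁺ {C = cliques} {v = v} (∈-cliques⁺ (inj₁ refl)))
           (∈-memberships⁺ {C = cliques} {v = v} (∈-cliques⁺ (inj₂ refl))) (a≢b (t v)))

  excess : sum (map (λ p → ∣ cliques p ∣ ∸ 1) (allFin (suc (suc n)))) ≡ n
  excess = trans (sum-map-allFin (λ p → ∣ cliques p ∣ ∸ 1)) (+-cancelʳ-≡ (suc (suc n)) _ n (begin
    ∑[ p < suc (suc n) ] (∣ cliques p ∣ ∸ 1) + suc (suc n) ≡⟨ ∑[∣C∣∸1]+k≡∑∣memberships∣ cliques nonempty ⟩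
    ∑[ v < suc n ] ∣ memberships cliques v ∣                ≡⟨ sum-cong-≗ ∣memberships∣≡2 ⟩
    ∑[ v < suc n ] 2                                         ≡⟨ ∑[2]≡n+[n+2] n ⟩
    n + suc (suc n)                                          ∎))
    where open ≡-Reasoning

  decomposition : CliqueDecomposition Γ
  decomposition = suc (suc n) , cliques , union , nonempty , cliques-meet-once ,
                  (λ v → ≤-reflexive (∣memberships∣≡2 v)) , excess

-- From a clique decomposition to a Carter labelling

module CliquesToCarter {n} {Γ : Graph (suc n)} (connected : Connected Γ) {k} {C : Fin k → Subset (suc n)}
  (union : IsUnionOfCliques Γ C) (nonempty : ∀ i → Nonempty (C i))
  (meet-once : ∀ i j → i ≢ j → ∣ C i ∩ C j ∣ ≤ 1) (at-most-two : ∀ v → ∣ memberships C v ∣ ≤ 2)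
  (excess : sum (map (λ i → ∣ C i ∣ ∸ 1) (allFin k)) ≡ n) where

  first : Fin (suc n) → Fin k
  first v = proj₁ (proj₁ union v)

  ∈-first : ∀ v → v ∈ C (first v)
  ∈-first v = proj₂ (proj₁ union v)

  third-clique-absent : ∀ {v i j l} → v ∈ C i → v ∈ C j → i ≢ j → i ≢ l → j ≢ l → v ∉ C l
  third-clique-absent {v} v∈i v∈j i≢j i≢l j≢l v∈l =
    <-irrefl refl (≤-trans (3≤∣p∣ (∈-memberships⁺ {C = C} {v = v} v∈i) (∈-memberships⁺ {C = C} {v = v} v∈j)
                                  (∈-memberships⁺ {C = C} {v = v} v∈l) i≢j i≢l j≢l) (at-most-two v))

  SecondClique : Fin (suc n) → Set
  SecondClique v = ∃[ j ] (j ≢ first v × v ∈ C j)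

  secondClique? : ∀ v → Dec (SecondClique v)
  secondClique? v = any? λ j → ¬? (j ≟ first v) ×-dec (v ∈? C j)

  loners : Subset (suc n)
  loners = subsetOf (¬? ∘ secondClique?)

  s : ℕ
  s = ∣ loners ∣

  -- The points are the k cliques together with one private point for each of the s vertices lying in a single clique.
  point : Fin k ⊎ Fin s → Fin (k + s)
  point = join k s

  point-injective : ∀ x y → point x ≡ point y → x ≡ y
  point-injective x y e = trans (sym (splitAt-join k s x)) (trans (cong (splitAt k) e) (splitAt-join k s y))

  partner : ∀ v → Dec (SecondClique v) → Fin k ⊎ Fin s
  partner v (yes (j , _)) = inj₁ j
  partner v (no ¬second)  = inj₂ (rank loners (∈-subsetOf⁺ (¬? ∘ secondClique?) ¬second))

  first≢partner : ∀ v (d : Dec (SecondClique v)) → point (inj₁ (first v)) ≢ point (partner v d)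
  first≢partner v (yes (j , j≢first , _)) e with point-injective (inj₁ (first v)) (inj₁ j) e
  ... | refl = j≢first refl
  first≢partner v (no _) e with point-injective (inj₁ (first v)) (inj₂ _) e
  ... | ()

  transpositionOf : ∀ v → Dec (SecondClique v) → Transposition (k + s)
  transpositionOf v d = ⟪ point (inj₁ (first v)) , point (partner v d) , first≢partner v d ⟫

  t : Fin (suc n) → Transposition (k + s)
  t v = transpositionOf v (secondClique? v)

  Carries : Fin (suc n) → Fin k ⊎ Fin s → Set
  Carries v (inj₁ i) = v ∈ C i
  Carries v (inj₂ j) = select loners j ≡ v

  point∈⇒carries : ∀ {v} (d : Dec (SecondClique v)) x → point x ∈ₜ transpositionOf v d → Carries v x
  point∈⇒carries {v} d x (inj₁ e) with point-injective x (inj₁ (first v)) e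
  ... | refl = ∈-first v
  point∈⇒carries (yes (j , _ , v∈j)) x (inj₂ e) with point-injective x (inj₁ j) e
  ... | refl = v∈j
  point∈⇒carries (no ¬second) x (inj₂ e) with point-injective x (inj₂ _) e
  ... | refl = select-rank loners _

  carries⇒point∈ : ∀ {v} (d : Dec (SecondClique v)) x → Carries v x → point x ∈ₜ transpositionOf v d
  carries⇒point∈ {v} d (inj₁ i) v∈i with i ≟ first v
  ... | yes refl = inj₁ refl
  carries⇒point∈ {v} (yes (j , j≢first , v∈j)) (inj₁ i) v∈i | no i≢first with i ≟ j
  ...   | yes refl = inj₂ refl
  ...   | no i≢j   = contradiction v∈i (third-clique-absent (∈-first v) v∈j (j≢first ∘ sym) (i≢first ∘ sym) (i≢j ∘ sym))
  carries⇒point∈ (no ¬second) (inj₁ i) v∈i | no i≢first = contradiction (i , i≢first , v∈i) ¬second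
  carries⇒point∈ (yes second) (inj₂ j) refl = contradiction second (∈-subsetOf⁻ (¬? ∘ secondClique?) (select∈ loners j))
  carries⇒point∈ (no ¬second) (inj₂ j) refl =
    inj₂ (cong (point ∘ inj₂) (select-injective loners (sym (select-rank loners _))))

  point∈ₜ⇒carries : ∀ {v} x → point x ∈ₜ t v → Carries v x
  point∈ₜ⇒carries {v} = point∈⇒carries (secondClique? v)

  carries⇒point∈ₜ : ∀ {v} x → Carries v x → point x ∈ₜ t v
  carries⇒point∈ₜ {v} = carries⇒point∈ (secondClique? v)

  naming : ∀ p → ∃[ x ] (point x ≡ p)
  naming p = splitAt k p , join-splitAt k s p

  supports-distinct : ∀ {u v} → u ≢ v → ¬ t u ⊆ₜ t v
  supports-distinct {u} {v} u≢v = distinct (secondClique? u)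
    where
    distinct : (d : Dec (SecondClique u)) → ¬ transpositionOf u d ⊆ₜ t v
    distinct (yes (j , j≢first , u∈j)) (first∈v , j∈v) =
      <-irrefl refl (≤-trans (2≤∣p∣ (x∈p∩q⁺ (∈-first u , u∈j)) (x∈p∩q⁺ (point∈ₜ⇒carries (inj₁ (first u)) first∈v ,
                                                                     point∈ₜ⇒carries (inj₁ j) j∈v)) u≢v)
                             (meet-once (first u) j (j≢first ∘ sym)))
    distinct (no ¬second) (_ , private∈v) = u≢v (trans (sym (select-rank loners _)) (point∈ₜ⇒carries (inj₂ _) private∈v))

  adjacency : AdjacentIffNoncommuting Γ t
  adjacency u v u≢v = adjacent⇒¬commute , ¬commute⇒adjacent
    where
    adjacent⇒¬commute : adj Γ u v ≡ true → ¬ Commute (toPerm (t u)) (toPerm (t v))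
    adjacent⇒¬commute u~v with proj₁ (proj₂ union u v u≢v) u~v
    ... | i , u∈i , v∈i = shared⇒¬commute (t u) (t v) (carries⇒point∈ₜ (inj₁ i) u∈i) (carries⇒point∈ₜ (inj₁ i) v∈i)
                                            (supports-distinct u≢v)
    ¬commute⇒adjacent : ¬ Commute (toPerm (t u)) (toPerm (t v)) → adj Γ u v ≡ true
    ¬commute⇒adjacent ¬commute with ¬commute⇒shared (t u) (t v) ¬commute
    ... | p , p∈u , p∈v with naming p
    ...   | x , refl with x | point∈ₜ⇒carries x p∈u | point∈ₜ⇒carries x p∈v
    ...     | inj₁ i | u∈i | v∈i = proj₂ (proj₂ union u v u≢v) (i , u∈i , v∈i)
    ...     | inj₂ j | refl | j↦v = contradiction j↦v u≢v

  cliquePoint : Fin k → Fin (k + s)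
  cliquePoint i = point (inj₁ i)

  linked-at : ∀ {v i j} → v ∈ C i → v ∈ C j → Linked t (cliquePoint i) (cliquePoint j)
  linked-at {i = i} {j} v∈i v∈j = step here _ (carries⇒point∈ₜ (inj₁ i) v∈i) (carries⇒point∈ₜ (inj₁ j) v∈j)

  linked-along : ∀ {v w i j} → Reach Γ v w → v ∈ C i → w ∈ C j → Linked t (cliquePoint i) (cliquePoint j)
  linked-along here                 v∈i w∈j = linked-at v∈i w∈j
  linked-along (step {u} {x} u~x x⇝w) u∈i w∈j with proj₁ (proj₂ union u x u≢x) u~x
    where
    u≢x : u ≢ x
    u≢x refl = contradiction (trans (sym u~x) (irrefl Γ u)) λ ()
  ... | l , u∈l , x∈l = linked-trans (linked-at u∈i u∈l) (linked-along x⇝w x∈l w∈j)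

  linked-to-base : ∀ x → Linked t (cliquePoint (first zero)) (point x)
  linked-to-base (inj₁ i) = let (w , w∈i) = nonempty i in linked-along (connected zero w) (∈-first zero) w∈i
  linked-to-base (inj₂ j) = step (linked-to-base (inj₁ (first (select loners j)))) (select loners j)
                                 (carries⇒point∈ₜ (inj₁ _) (∈-first _)) (carries⇒point∈ₜ (inj₂ j) refl)

  linked : AllLinked t
  linked p q with naming p | naming q
  ... | x , refl | y , refl = linked-trans (linked-sym (linked-to-base x)) (linked-to-base y)

  vertex-degree : ∀ v → ∣ memberships C v ∣ + indicator (lookup loners v) ≡ 2
  vertex-degree v rewrite lookup∘tabulate (λ w → does (¬? (secondClique? w))) v with secondClique? v
  ... | yes (j , j≢first , v∈j) = trans (+-identityʳ _)
    (≤-antisym (at-most-two v) (2≤∣p∣ (∈-memberships⁺ {C = C} (∈-first v)) (∈-memberships⁺ {C = C} v∈j) (j≢first ∘ sym)))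
  ... | no ¬second = cong (_+ 1) (≤-antisym (∣p∣≤1 {p = memberships C v} only-first)
                                            (1≤∣p∣ (∈-memberships⁺ {C = C} (∈-first v))))
    where
    is-first : ∀ {i} → i ∈ memberships C v → i ≡ first v
    is-first {i} i∈ with i ≟ first v
    ... | yes i≡first = i≡first
    ... | no i≢first  = contradiction (i , i≢first , ∈-memberships⁻ {C = C} i∈) ¬second
    only-first : ∀ {i j} → i ∈ memberships C v → j ∈ memberships C v → i ≡ j
    only-first i∈ j∈ = trans (is-first i∈) (sym (is-first j∈))

  point-count : k + s ≡ suc (suc n)
  point-count = +-cancelˡ-≡ n _ _ (begin
    n + (k + s)                                         ≡⟨ +-assoc n k s ⟨
    n + k + s                                           ≡⟨ cong (λ e → e + k + s) ∑[∣C∣∸1]≡n ⟨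
    ∑[ i < k ] (∣ C i ∣ ∸ 1) + k + s                    ≡⟨ cong₂ _+_ (∑[∣C∣∸1]+k≡∑∣memberships∣ C nonempty)
                                                                     (∣p∣≡∑indicator loners) ⟩
    ∑[ v < suc n ] ∣ memberships C v ∣ + ∑[ v < suc n ] lonely v ≡⟨ ∑-distrib-+ (∣_∣ ∘ memberships C) lonely ⟨
    ∑[ v < suc n ] (∣ memberships C v ∣ + lonely v)     ≡⟨ sum-cong-≗ vertex-degree ⟩
    ∑[ v < suc n ] 2                                    ≡⟨ ∑[2]≡n+[n+2] n ⟩
    n + suc (suc n)                                     ∎)
    where
    open ≡-Reasoning
    lonely : Fin (suc n) → ℕ
    lonely v = indicator (lookup loners v)
    ∑[∣C∣∸1]≡n : ∑[ i < k ] (∣ C i ∣ ∸ 1) ≡ n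
    ∑[∣C∣∸1]≡n = trans (sym (sum-map-allFin (λ i → ∣ C i ∣ ∸ 1))) excess

  carter : IsCarterA Γ
  carter = subst (λ m → Σ (Fin (suc n) → Transposition m) (CarterLabelling Γ)) point-count
                 (t , linked⇒generates t linked , adjacency)

corollary2p16 : (n : ℕ) → 1 ≤ n → (Γ : Graph n) →
    IsCarterA Γ ⇔ (Connected Γ × CliqueDecomposition Γ)
corollary2p16 (suc n) _ Γ = mk⇔
  (λ (t , generates , adjacency) →
     let open CarterToCliques {Γ = Γ} {t} generates adjacency in connected , decomposition)
  (λ (connected , _ , _ , union , nonempty , meet-once , at-most-two , excess) →
     CliquesToCarter.carter connected union nonempty meet-once at-most-two excess)
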